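{- Every $\gamma_t$-critical graph $G$ with minimum degree $\delta(G)\ge 2$ and $\gamma_t(G)=n-\Delta(G)$, where $n=|V(G)|$ and $\Delta(G)$ is the maximum degree, is connected.
   Context: For a graph $G$, a set $S\subseteq V(G)$ is a total dominating set if every vertex of $G$ is adjacent to some vertex of $S$; $\gamma_t(G)$ is the minimum size of such a set. A leaf is a vertex of degree one. A graph $G$ with no isolated vertex is $\gamma_t$-critical if $\gamma_t(G-v)<\gamma_t(G)$ for every vertex $v$ not adjacent to a leaf. -}

module Defs where

open import Data.Nat using (ℕ; zero; suc; _+_; _≤_; _<_)
open import Data.Bool using (Bool; true; false)
open import Data.Fin using (Fin; zero; suc; punchIn)
open import Data.Product using (Σ; ∃; _×_; _,_)
open import Relation.Binary.PropositionalEquality using (_≡_)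
open import Relation.Nullary using (¬_)

record Graph (n : ℕ) : Set where
  field
    adj    : Fin n → Fin n → Bool
    sym    : ∀ u v → adj u v ≡ adj v u
    irrefl : ∀ v → adj v v ≡ false
open Graph public

count : ∀ {n} → (Fin n → Bool) → ℕ
count {zero}  p = 0
count {suc n} p with p zero
... | true  = suc (count (λ i → p (suc i)))
... | false = count (λ i → p (suc i))

VSet : ℕ → Set
VSet n = Fin n → Bool

∣_∣ : ∀ {n} → VSet n → ℕ
∣ S ∣ = count S

deg : ∀ {n} → Graph n → Fin n → ℕ
deg G v = count (adj G v)

MinDegAtLeast : ∀ {n} → Graph n → ℕ → Set
MinDegAtLeast G k = ∀ v → k ≤ deg G v

IsMaxDegree : ∀ {n} → Graph n → ℕ → Set
IsMaxDegree G d = (∃ λ v → deg G v ≡ d) × (∀ v → deg G v ≤ d)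

IsLeaf : ∀ {n} → Graph n → Fin n → Set
IsLeaf G v = deg G v ≡ 1

NoIsolated : ∀ {n} → Graph n → Set
NoIsolated G = ∀ v → ¬ (deg G v ≡ 0)

IsTDS : ∀ {n} → Graph n → VSet n → Set
IsTDS G S = ∀ v → ∃ λ u → S u ≡ true × adj G v u ≡ true

IsGammaT : ∀ {n} → Graph n → ℕ → Set
IsGammaT G k = (∃ λ S → IsTDS G S × ∣ S ∣ ≡ k) × (∀ S → IsTDS G S → k ≤ ∣ S ∣)

delete : ∀ {n} → Graph (suc n) → Fin (suc n) → Graph n
delete G v = record
  { adj    = λ a b → adj G (punchIn v a) (punchIn v b)
  ; sym    = λ a b → sym G (punchIn v a) (punchIn v b)
  ; irrefl = λ a → irrefl G (punchIn v a)
  }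

IsGammaTCritical : ∀ {n} → Graph (suc n) → Set
IsGammaTCritical G =
  NoIsolated G ×
  (∀ v → ¬ (∃ λ u → adj G v u ≡ true × IsLeaf G u) →
     ∀ a b → IsGammaT (delete G v) a → IsGammaT G b → a < b)

data Reach {n} (G : Graph n) : Fin n → Fin n → Set where
  here : ∀ {u} → Reach G u u
  step : ∀ {u v w} → adj G u v ≡ true → Reach G v w → Reach G u w

Connected : ∀ {n} → Graph n → Set
Connected G = ∀ u v → Reach G u v

-- Suppose G were disconnected: take a union P of components containing a vertex
-- v of maximum degree Δ, and a vertex w outside P.  As δ(G) ≥ 2, w is adjacent
-- to no leaf, so by criticality a minimum total dominating set T of G − w has
-- fewer than γₜ(G) vertices; hence T contains no neighbour of w, for otherwise
-- T would totally dominate G.  Now totally dominate G as follows: inside P use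
-- v, one neighbour of v, and one neighbour of each vertex of P at distance ≥ 2
-- from v; outside P use the part of T outside P together with one neighbour of
-- w.  Outside P this saves the three vertices w and two of its neighbours, so
-- the set has at most n − Δ − 1 = γₜ(G) − 1 vertices, a contradiction.
module Submission where

open import Defs renaming (sym to adj-sym)
open import Data.Bool using (Bool; true; false; _∧_; _∨_; not; if_then_else_)
open import Data.Bool.Properties using (∧-conicalˡ; ∧-conicalʳ; ∧-identityʳ; ∧-zeroʳ; ¬-not) renaming (_≟_ to _≟ᵇ_)
open import Data.Fin using (Fin; zero; suc; punchIn; punchOut)
open import Data.Fin.Properties using (_≟_; punchInᵢ≢i; punchIn-punchOut; any?; all?)
open import Data.Fin.Subset using (Subset)
open import Data.Fin.Subset.Properties using (anySubset?)
open import Data.Vec using (lookup; tabulate)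
open import Data.Vec.Properties using (lookup∘tabulate)
open import Data.Nat using (ℕ; zero; suc; _+_; _≤_; _<_; z≤n; s≤s)
open import Data.Nat.Properties
  using (≤-refl; ≤-trans; ≤-reflexive; ≤-pred; <⇒≱; ≮⇒≥; _<?_; +-comm; +-assoc; +-cancelʳ-≡;
         +-mono-≤; +-monoˡ-≤; +-monoʳ-≤; +-mono-≤-<; +-commutativeSemigroup; module ≤-Reasoning)
open import Algebra.Properties.CommutativeSemigroup +-commutativeSemigroup using (interchange; x∙yz≈y∙xz)
open import Data.Product using (∃; ∃₂; _×_; _,_; proj₁; proj₂)
open import Data.Sum using (_⊎_; inj₁; inj₂; fromInj₁)
open import Data.Vec.Functional using (insertAt)
open import Data.Vec.Functional.Properties using (insertAt-lookup; insertAt-punchIn)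
open import Function using (_∘_)
open import Relation.Nullary using (¬_; Dec; yes; no; does; contradiction)
open import Relation.Nullary.Decidable using (dec-true; dec-false; _×-dec_)
open import Relation.Binary.PropositionalEquality

does-sound : ∀ {a} {A : Set a} (a? : Dec A) → does a? ≡ true → A
does-sound (yes a) _ = a

toℕ : Bool → ℕ
toℕ false = 0
toℕ true  = 1

module _ {n : ℕ} where

  infix  4 _∈_ _∉_ _⊆_
  infixr 6 _∪_
  infixr 7 _∩_
  infixl 8 _∖_

  _∈_ _∉_ : Fin n → VSet n → Set
  x ∈ A = A x ≡ true
  x ∉ A = A x ≡ false

  _⊆_ : VSet n → VSet n → Set
  A ⊆ B = ∀ x → x ∈ A → x ∈ B

  ∅ full : VSet n
  ∅    _ = false
  full _ = true

  ⁅_⁆ : Fin n → VSet n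
  ⁅ y ⁆ x = does (x ≟ y)

  _∪_ _∩_ : VSet n → VSet n → VSet n
  (A ∪ B) x = A x ∨ B x
  (A ∩ B) x = A x ∧ B x

  ∁ : VSet n → VSet n
  ∁ A x = not (A x)

  _∖_ : VSet n → Fin n → VSet n
  A ∖ y = A ∩ ∁ ⁅ y ⁆

  ∉⇒¬∈ : ∀ {x} A → x ∉ A → ¬ x ∈ A
  ∉⇒¬∈ A x∉A x∈A = contradiction (trans (sym x∈A) x∉A) λ ()

  ¬∈⇒∉ : ∀ {x} A → ¬ x ∈ A → x ∉ A
  ¬∈⇒∉ {x} A x∉A with A x
  ... | true  = contradiction refl x∉A
  ... | false = refl

  ∈∉⇒≢ : ∀ {x y} A → x ∈ A → y ∉ A → x ≢ y
  ∈∉⇒≢ A x∈A y∉A refl = ∉⇒¬∈ A y∉A x∈A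

  ∩-⊆ : ∀ A B → B ⊆ A → A ∩ B ≗ B
  ∩-⊆ A B B⊆A x with B x in x∈B
  ... | true  = trans (∧-identityʳ (A x)) (B⊆A x x∈B)
  ... | false = ∧-zeroʳ (A x)

  ∈⁅⁆ : ∀ x → x ∈ ⁅ x ⁆
  ∈⁅⁆ x = dec-true (x ≟ x) refl

  ∈⁅⁆⁻ : ∀ {x y} → x ∈ ⁅ y ⁆ → x ≡ y
  ∈⁅⁆⁻ {x} {y} = does-sound (x ≟ y)

  ∉⁅⁆ : ∀ {x y} → x ≢ y → x ∉ ⁅ y ⁆
  ∉⁅⁆ {x} {y} = dec-false (x ≟ y)

  ∪⁺ˡ : ∀ {x} A B → x ∈ A → x ∈ A ∪ B
  ∪⁺ˡ A B x∈A rewrite x∈A = refl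

  ∪⁺ʳ : ∀ {x} A B → x ∈ B → x ∈ A ∪ B
  ∪⁺ʳ {x} A B x∈B with A x
  ... | true  = refl
  ... | false = x∈B

  ∪⁻ : ∀ {x} A B → x ∈ A ∪ B → x ∈ A ⊎ x ∈ B
  ∪⁻ {x} A B x∈A∪B with A x
  ... | true  = inj₁ refl
  ... | false = inj₂ x∈A∪B

  ∩⁺ : ∀ {x} A B → x ∈ A → x ∈ B → x ∈ A ∩ B
  ∩⁺ A B x∈A x∈B rewrite x∈A = x∈B

  ∩⁻ˡ : ∀ {x} A B → x ∈ A ∩ B → x ∈ A
  ∩⁻ˡ {x} A B = ∧-conicalˡ (A x) (B x)

  ∩⁻ʳ : ∀ {x} A B → x ∈ A ∩ B → x ∈ B
  ∩⁻ʳ {x} A B = ∧-conicalʳ (A x) (B x)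

  ∁⁺ : ∀ {x} A → x ∉ A → x ∈ ∁ A
  ∁⁺ A = cong not

  ∁⁻ : ∀ {x} A → x ∈ ∁ A → x ∉ A
  ∁⁻ {x} A x∈∁A with A x
  ... | false = refl

  ∖⁺ : ∀ {x} A y → x ∈ A → x ≢ y → x ∈ A ∖ y
  ∖⁺ {x} A y x∈A x≢y = ∩⁺ A (∁ ⁅ y ⁆) x∈A (∁⁺ {x} ⁅ y ⁆ (∉⁅⁆ x≢y))

  ∖⁻ : ∀ {x} A y → x ∈ A ∖ y → x ≢ y
  ∖⁻ A y x∈A∖y refl = ∉⇒¬∈ {y} ⁅ y ⁆ (∁⁻ {y} ⁅ y ⁆ (∩⁻ʳ A (∁ ⁅ y ⁆) x∈A∖y)) (∈⁅⁆ y)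

count-suc : ∀ {n} (A : VSet (suc n)) → count A ≡ toℕ (A zero) + count (A ∘ suc)
count-suc A with A zero
... | true  = refl
... | false = refl

count-cong : ∀ {n} {A B : VSet n} → A ≗ B → count A ≡ count B
count-cong {zero}          A≗B = refl
count-cong {suc n} {A} {B} A≗B = begin
  count A                         ≡⟨ count-suc A ⟩
  toℕ (A zero) + count (A ∘ suc)  ≡⟨ cong₂ _+_ (cong toℕ (A≗B zero)) (count-cong (A≗B ∘ suc)) ⟩
  toℕ (B zero) + count (B ∘ suc)  ≡⟨ count-suc B ⟨
  count B                         ∎
  where open ≡-Reasoning

count-∅ : ∀ {n} → count {n} ∅ ≡ 0
count-∅ {zero}  = refl
count-∅ {suc n} = count-∅ {n}

count-full : ∀ {n} → count {n} full ≡ n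
count-full {zero}  = refl
count-full {suc n} = cong suc (count-full {n})

count≤n : ∀ {n} (A : VSet n) → count A ≤ n
count≤n {zero}  A = z≤n
count≤n {suc n} A rewrite count-suc A = +-mono-≤ (toℕ≤1 (A zero)) (count≤n (A ∘ suc))
  where
  toℕ≤1 : ∀ b → toℕ b ≤ 1
  toℕ≤1 false = z≤n
  toℕ≤1 true  = ≤-refl

toℕ-mono : ∀ {a b} → (a ≡ true → b ≡ true) → toℕ a ≤ toℕ b
toℕ-mono {false} _   = z≤n
toℕ-mono {true}  a⇒b rewrite a⇒b refl = ≤-refl

count-mono : ∀ {n} {A B : VSet n} → A ⊆ B → count A ≤ count B
count-mono {zero}          A⊆B = z≤n
count-mono {suc n} {A} {B} A⊆B rewrite count-suc A | count-suc B =
  +-mono-≤ (toℕ-mono (A⊆B zero)) (count-mono (A⊆B ∘ suc))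

count-< : ∀ {n} {A B : VSet n} {x} → A ⊆ B → x ∈ B → x ∉ A → count A < count B
count-< {suc n} {A} {B} {zero}  A⊆B x∈B x∉A rewrite count-suc A | count-suc B | x∈B | x∉A =
  s≤s (count-mono (A⊆B ∘ suc))
count-< {suc n} {A} {B} {suc x} A⊆B x∈B x∉A rewrite count-suc A | count-suc B =
  +-mono-≤-< (toℕ-mono (A⊆B zero)) (count-< (A⊆B ∘ suc) x∈B x∉A)

count-∪ : ∀ {n} (A B : VSet n) → count (A ∪ B) ≤ count A + count B
count-∪ {zero}  A B = z≤n
count-∪ {suc n} A B
  rewrite count-suc (A ∪ B) | count-suc A | count-suc B
        | interchange (toℕ (A zero)) (count (A ∘ suc)) (toℕ (B zero)) (count (B ∘ suc)) =
  +-mono-≤ (toℕ-∨ (A zero) (B zero)) (count-∪ (A ∘ suc) (B ∘ suc))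
  where
  toℕ-∨ : ∀ a b → toℕ (a ∨ b) ≤ toℕ a + toℕ b
  toℕ-∨ false b = ≤-refl
  toℕ-∨ true  b = s≤s z≤n

count-split : ∀ {n} (A B : VSet n) → count A ≡ count (A ∩ B) + count (A ∩ ∁ B)
count-split {zero}  A B = refl
count-split {suc n} A B
  rewrite count-suc A | count-suc (A ∩ B) | count-suc (A ∩ ∁ B)
        | interchange (toℕ (A zero ∧ B zero)) (count ((A ∩ B) ∘ suc))
                      (toℕ (A zero ∧ not (B zero))) (count ((A ∩ ∁ B) ∘ suc)) =
  cong₂ _+_ (toℕ-split (A zero) (B zero)) (count-split (A ∘ suc) (B ∘ suc))
  where
  toℕ-split : ∀ a b → toℕ a ≡ toℕ (a ∧ b) + toℕ (a ∧ not b)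
  toℕ-split false b     = refl
  toℕ-split true  false = refl
  toℕ-split true  true  = refl

count-punchIn : ∀ {n} (A : VSet (suc n)) w → count A ≡ toℕ (A w) + count (A ∘ punchIn w)
count-punchIn A zero = count-suc A
count-punchIn {suc n} A (suc w) = begin
  count A                                                              ≡⟨ count-suc A ⟩
  toℕ (A zero) + count (A ∘ suc)                                       ≡⟨ cong (toℕ (A zero) +_) (count-punchIn (A ∘ suc) w) ⟩
  toℕ (A zero) + (toℕ (A (suc w)) + count (A ∘ suc ∘ punchIn w))       ≡⟨ x∙yz≈y∙xz (toℕ (A zero)) (toℕ (A (suc w))) (count (A ∘ suc ∘ punchIn w)) ⟩
  toℕ (A (suc w)) + (toℕ (A zero) + count (A ∘ suc ∘ punchIn w))       ≡⟨ cong (toℕ (A (suc w)) +_) (count-suc (A ∘ punchIn (suc w))) ⟨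
  toℕ (A (suc w)) + count (A ∘ punchIn (suc w))                        ∎
  where open ≡-Reasoning

count-⁅⁆ : ∀ {n} (x : Fin (suc n)) → count ⁅ x ⁆ ≡ 1
count-⁅⁆ {n} x = begin
  count ⁅ x ⁆                                ≡⟨ count-punchIn ⁅ x ⁆ x ⟩
  toℕ (⁅ x ⁆ x) + count (⁅ x ⁆ ∘ punchIn x)  ≡⟨ cong₂ _+_ (cong toℕ (∈⁅⁆ x)) (count-cong λ y → ∉⁅⁆ {x = punchIn x y} (punchInᵢ≢i x y)) ⟩
  1 + count {n} ∅                            ≡⟨ cong suc (count-∅ {n}) ⟩
  1                                          ∎
  where open ≡-Reasoning

count-∖ : ∀ {n} (A : VSet n) {x} → x ∈ A → count A ≡ suc (count (A ∖ x))
count-∖ {suc n} A {x} x∈A = begin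
  count A                                ≡⟨ count-split A ⁅ x ⁆ ⟩
  count (A ∩ ⁅ x ⁆) + count (A ∖ x)      ≡⟨ cong (_+ count (A ∖ x)) (count-cong A∩⁅x⁆≗⁅x⁆) ⟩
  count ⁅ x ⁆ + count (A ∖ x)            ≡⟨ cong (_+ count (A ∖ x)) (count-⁅⁆ x) ⟩
  suc (count (A ∖ x))                    ∎
  where
  open ≡-Reasoning
  A∩⁅x⁆≗⁅x⁆ : A ∩ ⁅ x ⁆ ≗ ⁅ x ⁆
  A∩⁅x⁆≗⁅x⁆ y with y ≟ x
  ... | yes refl = trans (∧-identityʳ (A y)) x∈A
  ... | no  _    = ∧-zeroʳ (A y)

nonempty : ∀ {n} (A : VSet n) → 0 < count A → ∃ λ x → x ∈ A
nonempty {suc n} A 0<∣A∣ with A zero in A0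
... | true  = zero , A0
... | false with nonempty (A ∘ suc) 0<∣A∣
...   | x , x∈A = suc x , x∈A

two-distinct : ∀ {n} (A : VSet n) → 2 ≤ count A → ∃₂ λ x y → x ≢ y × x ∈ A × y ∈ A
two-distinct A 2≤∣A∣ with nonempty A (≤-trans (s≤s z≤n) 2≤∣A∣)
... | x , x∈A with nonempty (A ∖ x) (≤-pred (subst (2 ≤_) (count-∖ A x∈A) 2≤∣A∣))
...   | y , y∈A∖x = x , y , (λ x≡y → ∖⁻ A x y∈A∖x (sym x≡y)) , x∈A , ∩⁻ˡ A (∁ ⁅ x ⁆) y∈A∖x

image : ∀ {m n} → (Fin m → Fin n) → VSet m → VSet n
image {zero}  f A = ∅
image {suc m} f A = (if A zero then ⁅ f zero ⁆ else ∅) ∪ image (f ∘ suc) (A ∘ suc)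

image⁺ : ∀ {m n} (f : Fin m → Fin n) A {x} → x ∈ A → f x ∈ image f A
image⁺ f A {zero} x∈A rewrite x∈A =
  ∪⁺ˡ ⁅ f zero ⁆ (image (f ∘ suc) (A ∘ suc)) (∈⁅⁆ (f zero))
image⁺ f A {suc x} x∈A =
  ∪⁺ʳ (if A zero then ⁅ f zero ⁆ else ∅) (image (f ∘ suc) (A ∘ suc)) (image⁺ (f ∘ suc) (A ∘ suc) x∈A)

count-image : ∀ {m n} (f : Fin m → Fin (suc n)) A → count (image f A) ≤ count A
count-image {zero} {n} f A = ≤-reflexive (count-∅ {suc n})
count-image {suc m} {n} f A = begin
  count (image f A)                                                  ≤⟨ count-∪ (if A zero then ⁅ f zero ⁆ else ∅) (image (f ∘ suc) (A ∘ suc)) ⟩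
  count (if A zero then ⁅ f zero ⁆ else ∅) + count (image (f ∘ suc) (A ∘ suc))
                                                                     ≤⟨ +-mono-≤ (count-head (A zero)) (count-image (f ∘ suc) (A ∘ suc)) ⟩
  toℕ (A zero) + count (A ∘ suc)                                     ≡⟨ count-suc A ⟨
  count A                                                            ∎
  where
  open ≤-Reasoning
  count-head : ∀ b → count (if b then ⁅ f zero ⁆ else ∅) ≤ toℕ b
  count-head true  = ≤-reflexive (count-⁅⁆ (f zero))
  count-head false = ≤-reflexive (count-∅ {suc n})

-- Minimum total dominating sets

IsMinSize : ∀ {n} → (VSet n → Set) → ℕ → Set
IsMinSize P k = (∃ λ S → P S × ∣ S ∣ ≡ k) × (∀ S → P S → k ≤ ∣ S ∣)

minSize-exists : ∀ {n} (P : VSet n → Set) → (∀ S → Dec (P S)) → (∀ {S S′} → S ≗ S′ → P S → P S′) →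
                 ∀ S → P S → ∃ (IsMinSize P)
minSize-exists {n} P P? P-resp S P[S] = go (count S) S P[S] ≤-refl
  where
  smaller? : ∀ S → Dec (∃ λ (s : Subset n) → P (lookup s) × count (lookup s) < count S)
  smaller? S = anySubset? λ s → P? (lookup s) ×-dec count (lookup s) <? count S

  go : ∀ N S → P S → count S ≤ N → ∃ (IsMinSize P)
  go zero    S P[S] ∣S∣≤0 = count S , (S , P[S] , refl) , λ _ _ → ≤-trans ∣S∣≤0 z≤n
  go (suc N) S P[S] ∣S∣≤1+N with smaller? S
  ... | yes (s , P[s] , ∣s∣<∣S∣) = go N (lookup s) P[s] (≤-pred (≤-trans ∣s∣<∣S∣ ∣S∣≤1+N))
  ... | no ∄smaller = count S , (S , P[S] , refl) , λ S′ P[S′] → ≮⇒≥ λ ∣S′∣<∣S∣ →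
    let S′≗s = sym ∘ lookup∘tabulate S′ in
    ∄smaller (tabulate S′ , P-resp S′≗s P[S′] , subst (_< count S) (count-cong S′≗s) ∣S′∣<∣S∣)

isTDS? : ∀ {n} (G : Graph n) S → Dec (IsTDS G S)
isTDS? G S = all? λ v → any? λ u → S u ≟ᵇ true ×-dec adj G v u ≟ᵇ true

IsTDS-resp : ∀ {n} {G : Graph n} {S S′} → S ≗ S′ → IsTDS G S → IsTDS G S′
IsTDS-resp S≗S′ tds v = let u , u∈S , vu = tds v in u , trans (sym (S≗S′ u)) u∈S , vu

gammaT-exists : ∀ {n} (G : Graph n) S → IsTDS G S → ∃ (IsGammaT G)
gammaT-exists G = minSize-exists (IsTDS G) (isTDS? G) (IsTDS-resp {G = G})

-- Components

chain-stabilises : ∀ {n} (W : ℕ → VSet n) → (∀ j → W j ⊆ W (suc j)) → ∃ λ i → W (suc i) ⊆ W i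
chain-stabilises {n} W W↑ =
  fromInj₁ (λ 1+n≤∣W∣ → contradiction (count≤n (W (suc n))) (<⇒≱ 1+n≤∣W∣)) (grows (suc n))
  where
  grows : ∀ j → (∃ λ i → W (suc i) ⊆ W i) ⊎ (j ≤ count (W j))
  grows zero = inj₂ z≤n
  grows (suc j) with grows j
  ... | inj₁ stable = inj₁ stable
  ... | inj₂ j≤∣Wj∣ with any? (λ x → W (suc j) x ≟ᵇ true ×-dec W j x ≟ᵇ false)
  ...   | yes (x , new , ¬old) = inj₂ (≤-trans (s≤s j≤∣Wj∣) (count-< (W↑ j) new ¬old))
  ...   | no ∄new              = inj₁ (j , λ x x∈ → ¬-not λ ¬old → ∄new (x , x∈ , ¬old))

Reach-snoc : ∀ {n} {G : Graph n} {u x y} → Reach G u x → adj G x y ≡ true → Reach G u y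
Reach-snoc here        xy = step xy here
Reach-snoc (step ux r) xy = step ux (Reach-snoc r xy)

Closed : ∀ {n} → Graph n → VSet n → Set
Closed G P = ∀ x y → adj G x y ≡ true → P x ≡ P y

Closed-∈ : ∀ {n} (G : Graph n) P → Closed G P → ∀ {x y} → adj G x y ≡ true → x ∈ P → y ∈ P
Closed-∈ G P closed {x} {y} xy x∈P = trans (sym (closed x y xy)) x∈P

∁-closed : ∀ {n} (G : Graph n) P → Closed G P → Closed G (∁ P)
∁-closed G P closed x y xy = cong not (closed x y xy)

forward-closed⇒Closed : ∀ {n} (G : Graph n) P → (∀ {x y} → adj G x y ≡ true → x ∈ P → y ∈ P) → Closed G P
forward-closed⇒Closed G P fwd x y xy with P x in x∈P | P y in y∈P
... | true  | true  = refl
... | false | false = refl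
... | true  | false = trans (sym (fwd xy x∈P)) y∈P
... | false | true  = trans (sym x∈P) (fwd (trans (adj-sym G y x) xy) y∈P)

module _ {n} (G : Graph n) (u : Fin n) where

  adjacent-to? : ∀ A y → Dec (∃ λ x → x ∈ A × adj G x y ≡ true)
  adjacent-to? A y = any? λ x → A x ≟ᵇ true ×-dec adj G x y ≟ᵇ true

  neighbourhood : VSet n → VSet n
  neighbourhood A y = does (adjacent-to? A y)

  ball : ℕ → VSet n
  ball zero    = ⁅ u ⁆
  ball (suc j) = ball j ∪ neighbourhood (ball j)

  ball-reach : ∀ j {x} → x ∈ ball j → Reach G u x
  ball-reach zero {x} x∈ball = subst (Reach G u) (sym (∈⁅⁆⁻ {x = x} x∈ball)) here
  ball-reach (suc j) x∈ball with ∪⁻ (ball j) (neighbourhood (ball j)) x∈ball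
  ... | inj₁ x∈ball′ = ball-reach j x∈ball′
  ... | inj₂ x∈N     = let y , y∈ball , yx = does-sound (adjacent-to? (ball j) _) x∈N in Reach-snoc (ball-reach j y∈ball) yx

  u∈ball : ∀ j → u ∈ ball j
  u∈ball zero    = ∈⁅⁆ u
  u∈ball (suc j) = ∪⁺ˡ (ball j) (neighbourhood (ball j)) (u∈ball j)

  ball-stable : ∃ λ i → ball (suc i) ⊆ ball i
  ball-stable = chain-stabilises ball λ j _ → ∪⁺ˡ (ball j) (neighbourhood (ball j))

  component : VSet n
  component = ball (proj₁ ball-stable)

  component-reach : ∀ {x} → x ∈ component → Reach G u x
  component-reach = ball-reach (proj₁ ball-stable)

  u∈component : u ∈ component
  u∈component = u∈ball (proj₁ ball-stable)

  component-closed : Closed G component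
  component-closed = forward-closed⇒Closed G component λ {x} {y} xy x∈C →
    proj₂ ball-stable y (∪⁺ʳ component (neighbourhood component) (dec-true (adjacent-to? component y) (x , x∈C , xy)))

-- Total domination across a cut

adj⇒≢ : ∀ {n} (G : Graph n) {x y} → adj G x y ≡ true → x ≢ y
adj⇒≢ G {x} xy refl = contradiction (trans (sym xy) (irrefl G x)) λ ()

far : ∀ {n} → Graph n → Fin n → VSet n
far G v = ∁ (adj G v) ∖ v

deg+far : ∀ {n} (G : Graph n) v → deg G v + suc (count (far G v)) ≡ n
deg+far {n} G v = begin
  deg G v + suc (count (far G v))  ≡⟨ cong (deg G v +_) (count-∖ (∁ (adj G v)) (∁⁺ (adj G v) (irrefl G v))) ⟨
  deg G v + count (∁ (adj G v))    ≡⟨ count-split full (adj G v) ⟨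
  count {n} full                   ≡⟨ count-full ⟩
  n                                ∎
  where open ≡-Reasoning

∁-⊆-far : ∀ {n} (G : Graph n) P → Closed G P → ∀ {v} → v ∈ P → ∁ P ⊆ far G v
∁-⊆-far G P closed {v} v∈P x x∈∁P =
  ∖⁺ (∁ (adj G v)) v (∁⁺ (adj G v) (¬∈⇒∉ (adj G v) λ vx → x∉P (Closed-∈ G P closed vx v∈P))) λ { refl → x∉P v∈P }
  where
  x∉P : ¬ x ∈ P
  x∉P = ∉⇒¬∈ P (∁⁻ P x∈∁P)

Dominates : ∀ {n} → Graph n → VSet n → VSet n → Set
Dominates G D A = ∀ x → x ∈ A → ∃ λ y → y ∈ D × adj G x y ≡ true

dominates-∪-∁ : ∀ {n} (G : Graph n) {D D′} P → Dominates G D P → Dominates G D′ (∁ P) → IsTDS G (D ∪ D′)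
dominates-∪-∁ G {D} {D′} P dom dom′ x with P x in x∈P
... | true  = let y , y∈D  , xy = dom  x x∈P          in y , ∪⁺ˡ D D′ y∈D  , xy
... | false = let y , y∈D′ , xy = dom′ x (cong not x∈P) in y , ∪⁺ʳ D D′ y∈D′ , xy

insertAt-dominates : ∀ {n} (G : Graph (suc n)) w {T} → IsTDS (delete G w) T →
                     Dominates G (insertAt T w false) (full ∖ w)
insertAt-dominates G w {T} tds x x∈ =
  let w≢x = ∖⁻ full w x∈ ∘ sym
      y , y∈T , xy = tds (punchOut w≢x)
  in punchIn w y , trans (insertAt-punchIn T w false y) y∈T ,
     subst (λ z → adj G z (punchIn w y) ≡ true) (punchIn-punchOut w≢x) xy

count-insertAt : ∀ {n} (T : VSet n) w → count (insertAt T w false) ≡ count T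
count-insertAt T w = trans (count-punchIn (insertAt T w false) w)
  (cong₂ _+_ (cong toℕ (insertAt-lookup T w false)) (count-cong (insertAt-punchIn T w false)))

count-⁅⁆∪ : ∀ {n} (x : Fin (suc n)) A → count (⁅ x ⁆ ∪ A) ≤ suc (count A)
count-⁅⁆∪ x A = ≤-trans (count-∪ ⁅ x ⁆ A) (≤-reflexive (cong (_+ count A) (count-⁅⁆ x)))

near-dominator : ∀ {n} (G : Graph (suc n)) {f} → (∀ x → adj G x (f x) ≡ true) → ∀ v A →
                 ∃ λ D → Dominates G D A × count D ≤ 2 + count (far G v ∩ A)
near-dominator G {f} f-adj v A = ⁅ v ⁆ ∪ ⁅ f v ⁆ ∪ F , dom , ∣D∣≤
  where
  F = image f (far G v ∩ A)

  dom : Dominates G (⁅ v ⁆ ∪ ⁅ f v ⁆ ∪ F) A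
  dom x x∈A with x ≟ v
  ... | yes refl = f v , ∪⁺ʳ {x = f v} ⁅ v ⁆ (⁅ f v ⁆ ∪ F) (∪⁺ˡ {x = f v} ⁅ f v ⁆ F (∈⁅⁆ (f v))) , f-adj v
  ... | no x≢v with adj G v x in vx
  ...   | true  = v , ∪⁺ˡ {x = v} ⁅ v ⁆ (⁅ f v ⁆ ∪ F) (∈⁅⁆ v) , trans (adj-sym G x v) vx
  ...   | false = f x , ∪⁺ʳ {x = f x} ⁅ v ⁆ (⁅ f v ⁆ ∪ F) (∪⁺ʳ ⁅ f v ⁆ F (image⁺ f (far G v ∩ A) x∈far∩A)) , f-adj x
    where
    x∈far∩A : x ∈ far G v ∩ A
    x∈far∩A = ∩⁺ (far G v) A (∖⁺ (∁ (adj G v)) v (∁⁺ (adj G v) vx) x≢v) x∈A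

  ∣D∣≤ : count (⁅ v ⁆ ∪ ⁅ f v ⁆ ∪ F) ≤ 2 + count (far G v ∩ A)
  ∣D∣≤ = ≤-trans (count-⁅⁆∪ v (⁅ f v ⁆ ∪ F)) (s≤s (≤-trans (count-⁅⁆∪ (f v) F) (s≤s (count-image f (far G v ∩ A)))))

far-dominator : ∀ {n} (G : Graph (suc n)) P → Closed G P → ∀ {w a b T} → w ∉ P →
                adj G w a ≡ true → adj G w b ≡ true → a ≢ b →
                w ∉ T → a ∉ T → b ∉ T → Dominates G T (full ∖ w) →
                ∃ λ D → Dominates G D (∁ P) × 2 + count D ≤ count (∁ P)
far-dominator G P closed {w} {a} {b} {T} w∉P wa wb a≢b w∉T a∉T b∉T T-dom =
  ⁅ a ⁆ ∪ T ∩ ∁ P , dom , ∣D∣≤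
  where
  w∈∁P : w ∈ ∁ P
  w∈∁P = ∁⁺ P w∉P

  ∁P-adj : ∀ {x y} → adj G x y ≡ true → x ∈ ∁ P → y ∈ ∁ P
  ∁P-adj = Closed-∈ G (∁ P) (∁-closed G P closed)

  dom : Dominates G (⁅ a ⁆ ∪ T ∩ ∁ P) (∁ P)
  dom x x∈∁P with x ≟ w
  ... | yes refl = a , ∪⁺ˡ ⁅ a ⁆ (T ∩ ∁ P) (∈⁅⁆ a) , wa
  ... | no x≢w   = let y , y∈T , xy = T-dom x (∖⁺ {x = x} full w refl x≢w) in
    y , ∪⁺ʳ ⁅ a ⁆ (T ∩ ∁ P) (∩⁺ T (∁ P) y∈T (∁P-adj xy x∈∁P)) , xy

  ∁P₃ : VSet _
  ∁P₃ = ∁ P ∖ w ∖ a ∖ b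

  T∩∁P⊆∁P₃ : T ∩ ∁ P ⊆ ∁P₃
  T∩∁P⊆∁P₃ x x∈ = ∖⁺ (∁ P ∖ w ∖ a) b (∖⁺ (∁ P ∖ w) a (∖⁺ (∁ P) w x∈∁P (∈∉⇒≢ T x∈T w∉T)) (∈∉⇒≢ T x∈T a∉T)) (∈∉⇒≢ T x∈T b∉T)
    where
    x∈T   = ∩⁻ˡ T (∁ P) x∈
    x∈∁P  = ∩⁻ʳ T (∁ P) x∈

  ∣∁P∣≡3+∣∁P₃∣ : count (∁ P) ≡ 3 + count ∁P₃
  ∣∁P∣≡3+∣∁P₃∣ = begin
    count (∁ P)                ≡⟨ count-∖ (∁ P) w∈∁P ⟩
    1 + count (∁ P ∖ w)        ≡⟨ cong suc (count-∖ (∁ P ∖ w) a∈) ⟩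
    2 + count (∁ P ∖ w ∖ a)    ≡⟨ cong (2 +_) (count-∖ (∁ P ∖ w ∖ a) b∈) ⟩
    3 + count ∁P₃              ∎
    where
    open ≡-Reasoning
    a∈ : a ∈ ∁ P ∖ w
    a∈ = ∖⁺ {x = a} (∁ P) w (∁P-adj wa w∈∁P) (adj⇒≢ G wa ∘ sym)
    b∈ : b ∈ ∁ P ∖ w ∖ a
    b∈ = ∖⁺ {x = b} (∁ P ∖ w) a (∖⁺ {x = b} (∁ P) w (∁P-adj wb w∈∁P) (adj⇒≢ G wb ∘ sym)) (a≢b ∘ sym)

  ∣D∣≤ : 2 + count (⁅ a ⁆ ∪ T ∩ ∁ P) ≤ count (∁ P)
  ∣D∣≤ = begin
    2 + count (⁅ a ⁆ ∪ T ∩ ∁ P)  ≤⟨ s≤s (s≤s (count-⁅⁆∪ a (T ∩ ∁ P))) ⟩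
    3 + count (T ∩ ∁ P)          ≤⟨ s≤s (s≤s (s≤s (count-mono T∩∁P⊆∁P₃))) ⟩
    3 + count ∁P₃                ≡⟨ ∣∁P∣≡3+∣∁P₃∣ ⟨
    count (∁ P)                  ∎
    where open ≤-Reasoning

count-across-cut : ∀ {n} (G : Graph n) P → Closed G P → ∀ {v} → v ∈ P → ∀ (D D′ : VSet n) →
                   count D ≤ 2 + count (far G v ∩ P) → 2 + count D′ ≤ count (∁ P) →
                   count (D ∪ D′) ≤ count (far G v)
count-across-cut G P closed {v} v∈P D D′ ∣D∣≤ ∣D′∣≤ = begin
  count (D ∪ D′)                                ≤⟨ count-∪ D D′ ⟩
  count D + count D′                            ≤⟨ +-monoˡ-≤ (count D′) ∣D∣≤ ⟩
  2 + count (far G v ∩ P) + count D′            ≡⟨ +-assoc 2 (count (far G v ∩ P)) (count D′) ⟩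
  2 + (count (far G v ∩ P) + count D′)          ≡⟨ x∙yz≈y∙xz 2 (count (far G v ∩ P)) (count D′) ⟩
  count (far G v ∩ P) + (2 + count D′)          ≤⟨ +-monoʳ-≤ (count (far G v ∩ P)) ∣D′∣≤ ⟩
  count (far G v ∩ P) + count (∁ P)             ≡⟨ cong (count (far G v ∩ P) +_) (count-cong far∩∁P≗∁P) ⟨
  count (far G v ∩ P) + count (far G v ∩ ∁ P)   ≡⟨ count-split (far G v) P ⟨
  count (far G v)                               ∎
  where
  open ≤-Reasoning
  far∩∁P≗∁P : far G v ∩ ∁ P ≗ ∁ P
  far∩∁P≗∁P = ∩-⊆ (far G v) (∁ P) (∁-⊆-far G P closed v∈P)

module _ {n} (G : Graph (suc n)) (δ2 : MinDegAtLeast G 2) where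

  two-neighbours : ∀ x → ∃₂ λ y z → y ≢ z × adj G x y ≡ true × adj G x z ≡ true
  two-neighbours x = two-distinct (adj G x) (δ2 x)

  neighbour : Fin (suc n) → Fin (suc n)
  neighbour x = proj₁ (two-neighbours x)

  neighbour-adj : ∀ x → adj G x (neighbour x) ≡ true
  neighbour-adj x = proj₁ (proj₂ (proj₂ (proj₂ (two-neighbours x))))

  neighbour-≢ : ∀ x w → ∃ λ y → y ≢ w × adj G x y ≡ true
  neighbour-≢ x w with two-neighbours x
  ... | y , z , y≢z , xy , xz with y ≟ w
  ...   | no y≢w   = y , y≢w , xy
  ...   | yes refl = z , y≢z ∘ sym , xz

  no-leaf-neighbour : ∀ w → ¬ ∃ λ u → adj G w u ≡ true × IsLeaf G u
  no-leaf-neighbour w (u , _ , deg≡1) = contradiction (subst (2 ≤_) deg≡1 (δ2 u)) λ { (s≤s ()) }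

  delete-full-tds : ∀ w → IsTDS (delete G w) full
  delete-full-tds w x =
    let y , y≢w , xy = neighbour-≢ (punchIn w x) w
        w≢y = y≢w ∘ sym
    in punchOut w≢y , refl , subst (λ z → adj G (punchIn w x) z ≡ true) (sym (punchIn-punchOut w≢y)) xy

module _ {n} {G : Graph (suc n)} (crit : IsGammaTCritical G) (δ2 : MinDegAtLeast G 2) {k} (γ : IsGammaT G k) where

  critical-dominator : ∀ w → ∃ λ T → w ∉ T × Dominates G T (full ∖ w) × (∀ y → adj G w y ≡ true → y ∉ T)
  critical-dominator w with gammaT-exists (delete G w) full (delete-full-tds G δ2 w)
  ... | γ₋ , (T , T-tds , ∣T∣≡γ₋) , T-min = T⁺ , insertAt-lookup T w false , T⁺-dom , N[w]∩T⁺≡∅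
    where
    T⁺ = insertAt T w false
    T⁺-dom = insertAt-dominates G w T-tds

    γ₋<k : γ₋ < k
    γ₋<k = proj₂ crit w (no-leaf-neighbour G δ2 w) γ₋ k ((T , T-tds , ∣T∣≡γ₋) , T-min) γ

    N[w]∩T⁺≡∅ : ∀ y → adj G w y ≡ true → y ∉ T⁺
    N[w]∩T⁺≡∅ y wy = ¬∈⇒∉ T⁺ λ y∈T⁺ →
      <⇒≱ γ₋<k (subst (k ≤_) (trans (count-insertAt T w) ∣T∣≡γ₋) (proj₂ γ T⁺ (T⁺-tds y∈T⁺)))
      where
      T⁺-tds : y ∈ T⁺ → IsTDS G T⁺
      T⁺-tds y∈T⁺ x with x ≟ w
      ... | yes refl = y , y∈T⁺ , wy
      ... | no  x≢w  = T⁺-dom x (∖⁺ {x = x} full w refl x≢w)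

  small-tds-across-cut : ∀ P → Closed G P → ∀ {v w} → v ∈ P → w ∉ P →
                         ∃ λ S → IsTDS G S × count S ≤ count (far G v)
  -- The implicit arguments of far-dominator are passed explicitly: inferring T
  -- would make Agda unfold the exhaustive search behind critical-dominator.
  small-tds-across-cut P closed {v} {w} v∈P w∉P =
    let T , w∉T , T-dom , N[w]∩T≡∅ = critical-dominator w
        a , b , a≢b , wa , wb       = two-neighbours G δ2 w
        D , D-dom , ∣D∣≤            = near-dominator G (neighbour-adj G δ2) v P
        D′ , D′-dom , ∣D′∣≤         = far-dominator G P closed {w} {a} {b} {T}
                                        w∉P wa wb a≢b w∉T (N[w]∩T≡∅ a wa) (N[w]∩T≡∅ b wb) T-dom
    in D ∪ D′ , dominates-∪-∁ G P D-dom D′-dom , count-across-cut G P closed v∈P D D′ ∣D∣≤ ∣D′∣≤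

  module _ {d v} (deg-v : deg G v ≡ d) (k+d≡1+n : k + d ≡ suc n) where

    k≡1+∣far∣ : k ≡ suc (count (far G v))
    k≡1+∣far∣ = +-cancelʳ-≡ d k (suc (count (far G v))) (begin
      k + d                         ≡⟨ k+d≡1+n ⟩
      suc n                         ≡⟨ deg+far G v ⟨
      deg G v + suc (count (far G v)) ≡⟨ cong (_+ suc (count (far G v))) deg-v ⟩
      d + suc (count (far G v))     ≡⟨ +-comm d (suc (count (far G v))) ⟩
      suc (count (far G v)) + d     ∎)
      where open ≡-Reasoning

    closed-∋v-full : ∀ P → Closed G P → v ∈ P → ∀ w → w ∈ P
    closed-∋v-full P closed v∈P w with P w in w∈P
    ... | true  = refl
    ... | false = let S , S-tds , ∣S∣≤ = small-tds-across-cut P closed v∈P w∈P in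
      contradiction (proj₂ γ S S-tds) (<⇒≱ (subst (count S <_) (sym k≡1+∣far∣) (s≤s ∣S∣≤)))

    closed-nonempty-full : ∀ P → Closed G P → ∀ {u} → u ∈ P → ∀ w → w ∈ P
    closed-nonempty-full P closed {u} u∈P with P v in v∈P
    ... | true  = closed-∋v-full P closed v∈P
    ... | false = contradiction u∈P (∉⇒¬∈ P (∁⁻ P (closed-∋v-full (∁ P) (∁-closed G P closed) (∁⁺ P v∈P) u)))

lemma8 : ∀ {n} (G : Graph (suc n)) → IsGammaTCritical G → MinDegAtLeast G 2 →
    ∀ k d → IsGammaT G k → IsMaxDegree G d → k + d ≡ suc n → Connected G
lemma8 G crit δ2 k d γ ((v , deg-v) , _) k+d≡1+n u w =
  component-reach G u
    (closed-nonempty-full {G = G} crit δ2 γ deg-v k+d≡1+n (component G u) (component-closed G u) (u∈component G u) w)
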